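{- For every proposition symbol $x$ and every PLTL formula $W$, the number of new proposition symbols introduced by the translation $\tau_1[\Box(x\Rightarrow W)]$ is at most $4\cdot\mathrm{len}(W)$.
   Context: PLTL formulae are built from proposition symbols, $\mathbf{true}$, $\mathbf{false}$, $\neg,\vee,\wedge,\Rightarrow$ and temporal operators $\bigcirc$ (next), $\Diamond$ (sometime), $\Box$ (always), $\mathcal{U}$ (until), $\mathcal{W}$ (unless); $\mathbf{start}$ is a nullary connective true only at the first moment. A literal is a proposition symbol or its negation. A PLTL-clause is $\mathbf{start}\Rightarrow\bigvee_c l_c$, $\bigwedge_a k_a\Rightarrow\bigcirc\bigvee_d l_d$ or $\bigwedge_b k_b\Rightarrow\Diamond l$ with all $k,l$ literals. $\tau_1$, applied to $\Box(x\Rightarrow W)$ ($x$ a proposition symbol), is computed by applying the following rewrite rules repeatedly until the result is a conjunction of formulae $\Box A_i$, each $A_i$ a PLTL-clause (write $\tau_1[x\Rightarrow A]$ for $\tau_1[\Box(x\Rightarrow A)]$; $y,z,v$ are proposition symbols new at each application; $l,m,l_i$ literals; $\neg\mathbf{true}$, $\neg\mathbf{false}$ rewritten to $\mathbf{false}$, $\mathbf{true}$). (1) $x\Rightarrow(A\wedge B)\mapsto\tau_1[x\Rightarrow A]\wedge\tau_1[x\Rightarrow B]$; $x\Rightarrow(A\Rightarrow B)\mapsto\tau_1[x\Rightarrow\neg A\vee B]$; $x\Rightarrow\neg(A\wedge B)\mapsto\tau_1[x\Rightarrow\neg A\vee\neg B]$; $x\Rightarrow\neg(A\Rightarrow B)\mapsto\tau_1[x\Rightarrow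 A]\wedge\tau_1[x\Rightarrow\neg B]$; $x\Rightarrow\neg(A\vee B)\mapsto\tau_1[x\Rightarrow\neg A]\wedge\tau_1[x\Rightarrow\neg B]$. (2) $x\Rightarrow\bigcirc A\mapsto\Box(x\Rightarrow\bigcirc y)\wedge\tau_1[y\Rightarrow A]$ if $A$ is neither a literal nor a disjunction of literals; $x\Rightarrow\neg\bigcirc A\mapsto\Box(x\Rightarrow\bigcirc y)\wedge\tau_1[y\Rightarrow\neg A]$; $x\Rightarrow\Box A\mapsto\tau_1[x\Rightarrow\Box y]\wedge\tau_1[y\Rightarrow A]$ ($A$ not a literal); $x\Rightarrow\neg\Box A\mapsto\Box(x\Rightarrow\Diamond y)\wedge\tau_1[y\Rightarrow\neg A]$; $x\Rightarrow\Diamond A\mapsto\Box(x\Rightarrow\Diamond y)\wedge\tau_1[y\Rightarrow A]$ ($A$ not a literal); $x\Rightarrow\neg\Diamond A\mapsto\tau_1[x\Rightarrow\Box y]\wedge\tau_1[y\Rightarrow\neg A]$; $x\Rightarrow A\,\mathcal{U}\,B\mapsto\tau_1[x\Rightarrow y\,\mathcal{U}\,B]\wedge\tau_1[y\Rightarrow A]$ ($A$ not a literal), $\mapsto\tau_1[x\Rightarrow A\,\mathcal{U}\,y]\wedge\tau_1[y\Rightarrow B]$ ($B$ not a literal); the same with $\mathcal{W}$ for $\mathcal{U}$; $x\Rightarrow\neg(A\,\mathcal{U}\,B)\mapsto\tau_1[x\Rightarrow y\,\mathcal{W}\,v]\wedge\tau_1[y\Rightarrow\neg B]\wedge\tau_1[v\Rightarrow(y\wedge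 z)]\wedge\tau_1[z\Rightarrow\neg A]$; $x\Rightarrow\neg(A\,\mathcal{W}\,B)\mapsto\tau_1[x\Rightarrow y\,\mathcal{U}\,v]\wedge\tau_1[y\Rightarrow\neg B]\wedge\tau_1[v\Rightarrow(y\wedge z)]\wedge\tau_1[z\Rightarrow\neg A]$. (3) $x\Rightarrow\Box l\mapsto\tau_1[x\Rightarrow l]\wedge\tau_1[x\Rightarrow y]\wedge\Box(y\Rightarrow\bigcirc l)\wedge\Box(y\Rightarrow\bigcirc y)$; $x\Rightarrow l\,\mathcal{U}\,m\mapsto\Box(x\Rightarrow\Diamond m)\wedge\tau_1[x\Rightarrow l\vee m]\wedge\tau_1[x\Rightarrow y\vee m]\wedge\Box(y\Rightarrow\bigcirc(l\vee m))\wedge\Box(y\Rightarrow\bigcirc(y\vee m))$; $x\Rightarrow l\,\mathcal{W}\,m\mapsto$ the same without $\Box(x\Rightarrow\Diamond m)$. (4) $x\Rightarrow D\vee A\mapsto\tau_1[x\Rightarrow D\vee y]\wedge\tau_1[y\Rightarrow A]$, $D$ a disjunction, $A$ neither a literal nor a disjunction of literals. (5) $x\Rightarrow D\mapsto\Box(\mathbf{start}\Rightarrow\neg x\vee D)\wedge\Box(\mathbf{true}\Rightarrow\bigcirc(\neg x\vee D))$ for $D$ a literal or disjunction of literals; $x\Rightarrow\mathbf{true}\mapsto\Box(\mathbf{start}\Rightarrow\mathbf{true})\wedge\Box(\mathbf{true}\Rightarrow\bigcirc\mathbf{true})$; $x\Rightarrow\mathbf{false}\mapsto\Box(\mathbf{start}\Rightarrow\neg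 x)\wedge\Box(\mathbf{true}\Rightarrow\bigcirc\neg x)$; $\tau_1[x\Rightarrow\Diamond l]=\Box(x\Rightarrow\Diamond l)$; $\tau_1[x\Rightarrow\bigcirc(l_1\vee\dots\vee l_n)]=\Box(x\Rightarrow\bigcirc(l_1\vee\dots\vee l_n))$. Length: $\mathrm{len}(\Diamond l)=1$; $\mathrm{len}(l_1\vee\dots\vee l_n)=1$ ($n\ge1$); $\mathrm{len}(c)=1$ for $c\in\{\mathbf{true},\neg\mathbf{true},\mathbf{false},\neg\mathbf{false}\}$; $\mathrm{len}(\bigcirc(l_1\vee\dots\vee l_n))=1$; $\mathrm{len}(\neg\Box A)=\mathrm{len}(\neg\Diamond A)=\mathrm{len}(\neg\bigcirc A)=1+\mathrm{len}(\neg A)$; $\mathrm{len}(\Box A)=1+\mathrm{len}(A)$; $\mathrm{len}(\Diamond A)=1+\mathrm{len}(A)$ ($A$ not a literal); $\mathrm{len}(\bigcirc A)=1+\mathrm{len}(A)$ ($A$ not a disjunction of literals); for $\circ\in\{\mathcal{U},\mathcal{W},\vee,\wedge\}$: $\mathrm{len}(\neg(A\circ B))=1+\mathrm{len}(\neg A)+\mathrm{len}(\neg B)$ and $\mathrm{len}(A\circ B)=1+\mathrm{len}(A)+\mathrm{len}(B)$ (for $\vee$: $A,B$ not disjunctions of literals); $\mathrm{len}(\neg(A\Rightarrow B))=1+\mathrm{len}(A)+\mathrm{len}(\neg B)$; $\mathrm{len}(A\Rightarrow B)=1+\mathrm{len}(\neg A)+\mathrm{len}(B)$. -}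

module Defs where

open import Data.Nat using (ℕ; _+_)
open import Data.Bool using (Bool; true; false; _∧_; if_then_else_)
open import Data.List using (List; []; _∷_; _++_)
open import Relation.Binary.PropositionalEquality using (_≡_)

Sym : Set
Sym = ℕ

-- PLTL formulae (the nullary connective start only occurs in clauses,
-- which are not represented here)
infixr 4 _∨'_
infixr 5 _∧'_
infixr 3 _⇒'_
infix 6 _𝒰_ _𝒲_
data Formula : Set where
  var   : Sym → Formula
  ⊤'    : Formula
  ⊥'    : Formula
  ¬'_   : Formula → Formula
  _∨'_  : Formula → Formula → Formula
  _∧'_  : Formula → Formula → Formula
  _⇒'_  : Formula → Formula → Formula
  ○_    : Formula → Formula
  ◇_    : Formula → Formula
  □_    : Formula → Formula
  _𝒰_   : Formula → Formula → Formula
  _𝒲_   : Formula → Formula → Formula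

isLit : Formula → Bool
isLit (var p)      = true
isLit (¬' (var p)) = true
isLit _            = false

isDisjLit : Formula → Bool
isDisjLit (A ∨' B) = isDisjLit A ∧ isDisjLit B
isDisjLit A        = isLit A

-- the length function len(W) of the paper; lenNeg A = len(¬A)
mutual
  len : Formula → ℕ
  len (var p)   = 1
  len ⊤'        = 1
  len ⊥'        = 1
  len (¬' A)    = lenNeg A
  len (A ∨' B)  = if isDisjLit (A ∨' B) then 1 else 1 + len A + len B
  len (A ∧' B)  = 1 + len A + len B
  len (A ⇒' B)  = 1 + lenNeg A + len B
  len (○ A)     = if isDisjLit A then 1 else 1 + len A
  len (◇ A)     = if isLit A then 1 else 1 + len A
  len (□ A)     = 1 + len A
  len (A 𝒰 B)   = 1 + len A + len B
  len (A 𝒲 B)   = 1 + len A + len B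

  lenNeg : Formula → ℕ
  lenNeg (var p)  = 1
  lenNeg ⊤'       = 1
  lenNeg ⊥'       = 1
  lenNeg (¬' A)   = len A
  lenNeg (A ∨' B) = 1 + lenNeg A + lenNeg B
  lenNeg (A ∧' B) = 1 + lenNeg A + lenNeg B
  lenNeg (A ⇒' B) = 1 + len A + lenNeg B
  lenNeg (○ A)    = 1 + lenNeg A
  lenNeg (◇ A)    = 1 + lenNeg A
  lenNeg (□ A)    = 1 + lenNeg A
  lenNeg (A 𝒰 B)  = 1 + lenNeg A + lenNeg B
  lenNeg (A 𝒲 B)  = 1 + lenNeg A + lenNeg B

-- τ₁[ x ⇒ W ] ↝ ys : one complete run of the rewrite system τ₁ on
-- □(x ⇒ W), where ys lists the new proposition symbols introduced, in
-- order (one entry per new symbol y, z, v created by a rule application).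
-- Each constructor is one rewrite rule; its premises are the τ₁[...] calls
-- on the right-hand side of the rule (directly produced clauses □(...)
-- contribute no premise).
data τ₁[_⇒_]↝_ : Sym → Formula → List Sym → Set where
  r-and   : ∀ {x A B ys zs} → τ₁[ x ⇒ A ]↝ ys → τ₁[ x ⇒ B ]↝ zs →
            τ₁[ x ⇒ A ∧' B ]↝ (ys ++ zs)
  r-imp   : ∀ {x A B ys} → τ₁[ x ⇒ (¬' A) ∨' B ]↝ ys → τ₁[ x ⇒ A ⇒' B ]↝ ys
  r-nand  : ∀ {x A B ys} → τ₁[ x ⇒ (¬' A) ∨' (¬' B) ]↝ ys →
            τ₁[ x ⇒ ¬' (A ∧' B) ]↝ ys
  r-nimp  : ∀ {x A B ys zs} → τ₁[ x ⇒ A ]↝ ys → τ₁[ x ⇒ ¬' B ]↝ zs →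
            τ₁[ x ⇒ ¬' (A ⇒' B) ]↝ (ys ++ zs)
  r-nor   : ∀ {x A B ys zs} → τ₁[ x ⇒ ¬' A ]↝ ys → τ₁[ x ⇒ ¬' B ]↝ zs →
            τ₁[ x ⇒ ¬' (A ∨' B) ]↝ (ys ++ zs)
  r-next  : ∀ {x y A ys} → isDisjLit A ≡ false → τ₁[ y ⇒ A ]↝ ys →
            τ₁[ x ⇒ ○ A ]↝ (y ∷ ys)
  r-nnext : ∀ {x y A ys} → τ₁[ y ⇒ ¬' A ]↝ ys → τ₁[ x ⇒ ¬' (○ A) ]↝ (y ∷ ys)
  r-alw   : ∀ {x y A ys zs} → isLit A ≡ false →
            τ₁[ x ⇒ □ (var y) ]↝ ys → τ₁[ y ⇒ A ]↝ zs →
            τ₁[ x ⇒ □ A ]↝ (y ∷ ys ++ zs)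
  r-nalw  : ∀ {x y A ys} → τ₁[ y ⇒ ¬' A ]↝ ys → τ₁[ x ⇒ ¬' (□ A) ]↝ (y ∷ ys)
  r-ev    : ∀ {x y A ys} → isLit A ≡ false → τ₁[ y ⇒ A ]↝ ys →
            τ₁[ x ⇒ ◇ A ]↝ (y ∷ ys)
  r-nev   : ∀ {x y A ys zs} → τ₁[ x ⇒ □ (var y) ]↝ ys → τ₁[ y ⇒ ¬' A ]↝ zs →
            τ₁[ x ⇒ ¬' (◇ A) ]↝ (y ∷ ys ++ zs)
  r-untilL : ∀ {x y A B ys zs} → isLit A ≡ false →
            τ₁[ x ⇒ var y 𝒰 B ]↝ ys → τ₁[ y ⇒ A ]↝ zs →
            τ₁[ x ⇒ A 𝒰 B ]↝ (y ∷ ys ++ zs)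
  r-untilR : ∀ {x y A B ys zs} → isLit B ≡ false →
            τ₁[ x ⇒ A 𝒰 var y ]↝ ys → τ₁[ y ⇒ B ]↝ zs →
            τ₁[ x ⇒ A 𝒰 B ]↝ (y ∷ ys ++ zs)
  r-unlessL : ∀ {x y A B ys zs} → isLit A ≡ false →
            τ₁[ x ⇒ var y 𝒲 B ]↝ ys → τ₁[ y ⇒ A ]↝ zs →
            τ₁[ x ⇒ A 𝒲 B ]↝ (y ∷ ys ++ zs)
  r-unlessR : ∀ {x y A B ys zs} → isLit B ≡ false →
            τ₁[ x ⇒ A 𝒲 var y ]↝ ys → τ₁[ y ⇒ B ]↝ zs →
            τ₁[ x ⇒ A 𝒲 B ]↝ (y ∷ ys ++ zs)
  r-nuntil : ∀ {x y z v A B as bs cs ds} →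
            τ₁[ x ⇒ var y 𝒲 var v ]↝ as → τ₁[ y ⇒ ¬' B ]↝ bs →
            τ₁[ v ⇒ var y ∧' var z ]↝ cs → τ₁[ z ⇒ ¬' A ]↝ ds →
            τ₁[ x ⇒ ¬' (A 𝒰 B) ]↝ (y ∷ z ∷ v ∷ as ++ bs ++ cs ++ ds)
  r-nunless : ∀ {x y z v A B as bs cs ds} →
            τ₁[ x ⇒ var y 𝒰 var v ]↝ as → τ₁[ y ⇒ ¬' B ]↝ bs →
            τ₁[ v ⇒ var y ∧' var z ]↝ cs → τ₁[ z ⇒ ¬' A ]↝ ds →
            τ₁[ x ⇒ ¬' (A 𝒲 B) ]↝ (y ∷ z ∷ v ∷ as ++ bs ++ cs ++ ds)
  r-alwLit : ∀ {x y l ys zs} → isLit l ≡ true →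
            τ₁[ x ⇒ l ]↝ ys → τ₁[ x ⇒ var y ]↝ zs →
            τ₁[ x ⇒ □ l ]↝ (y ∷ ys ++ zs)
  r-untilLit : ∀ {x y l m ys zs} → isLit l ≡ true → isLit m ≡ true →
            τ₁[ x ⇒ l ∨' m ]↝ ys → τ₁[ x ⇒ var y ∨' m ]↝ zs →
            τ₁[ x ⇒ l 𝒰 m ]↝ (y ∷ ys ++ zs)
  r-unlessLit : ∀ {x y l m ys zs} → isLit l ≡ true → isLit m ≡ true →
            τ₁[ x ⇒ l ∨' m ]↝ ys → τ₁[ x ⇒ var y ∨' m ]↝ zs →
            τ₁[ x ⇒ l 𝒲 m ]↝ (y ∷ ys ++ zs)
  r-disjR : ∀ {x y D A ys zs} → isDisjLit A ≡ false →
            τ₁[ x ⇒ D ∨' var y ]↝ ys → τ₁[ y ⇒ A ]↝ zs →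
            τ₁[ x ⇒ D ∨' A ]↝ (y ∷ ys ++ zs)
  r-disjL : ∀ {x y D A ys zs} → isDisjLit A ≡ false →
            τ₁[ x ⇒ var y ∨' D ]↝ ys → τ₁[ y ⇒ A ]↝ zs →
            τ₁[ x ⇒ A ∨' D ]↝ (y ∷ ys ++ zs)
  r-clause : ∀ {x D} → isDisjLit D ≡ true → τ₁[ x ⇒ D ]↝ []
  r-true   : ∀ {x} → τ₁[ x ⇒ ⊤' ]↝ []
  r-false  : ∀ {x} → τ₁[ x ⇒ ⊥' ]↝ []
  r-evLit  : ∀ {x l} → isLit l ≡ true → τ₁[ x ⇒ ◇ l ]↝ []
  r-nextD  : ∀ {x D} → isDisjLit D ≡ true → τ₁[ x ⇒ ○ D ]↝ []
  r-ntrue  : ∀ {x ys} → τ₁[ x ⇒ ⊥' ]↝ ys → τ₁[ x ⇒ ¬' ⊤' ]↝ ys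
  r-nfalse : ∀ {x ys} → τ₁[ x ⇒ ⊤' ]↝ ys → τ₁[ x ⇒ ¬' ⊥' ]↝ ys
  r-dneg   : ∀ {x A ys} → τ₁[ x ⇒ A ]↝ ys → τ₁[ x ⇒ ¬' (¬' A) ]↝ ys

{-# OPTIONS --safe #-}
module Submission where

open import Defs
open import Data.Bool using (true; false; _∧_)
open import Data.Bool.Properties using (∧-identityʳ; ∧-zeroʳ)
open import Data.Nat using (ℕ; suc; _+_; _*_; _≤_; _<_; z≤n; s≤s)
open import Data.Nat.Properties
open import Data.List using (List; _∷_; _++_; length)
open import Data.List.Properties using (length-++; ++-identityʳ)
open import Relation.Binary.PropositionalEquality

-- We prove the stronger bound 4 + |ys| ≤ 4 · len W, i.e. at most 4 (len W − 1) new symbols,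
-- by induction on the translation.  Peeling off one connective leaves at least four symbols of
-- budget for the rule itself: its own fresh names plus those of its auxiliary obligations on
-- fresh symbols (x ⇒ □y, x ⇒ y 𝒲 v, v ⇒ y ∧ z, ...), each translated with at most one further
-- symbol.  The renaming rules for 𝒰, 𝒲 and ∨ are the exception: their auxiliary obligation,
-- e.g. x ⇒ y 𝒰 B, still contains B, but it costs fewer than 4 · len B symbols, which leaves
-- room for y.  A disjunction of literals has length 1, so the strengthened bound forces its
-- translation to be symbol-free.

isLit⇒isDisjLit : ∀ l → isLit l ≡ true → isDisjLit l ≡ true
isLit⇒isDisjLit (var _) _ = refl
isLit⇒isDisjLit (¬' _)  h = h

len-disjLit : ∀ D → isDisjLit D ≡ true → len D ≡ 1
len-disjLit (var _)    _ = refl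
len-disjLit (¬' var _) _ = refl
len-disjLit (_ ∨' _)   h rewrite h = refl

isDisjLit-lit∨lit : ∀ {l m} → isLit l ≡ true → isLit m ≡ true → isDisjLit (l ∨' m) ≡ true
isDisjLit-lit∨lit hl hm = cong₂ _∧_ (isLit⇒isDisjLit _ hl) (isLit⇒isDisjLit _ hm)

len-lit : ∀ l → isLit l ≡ true → len l ≡ 1
len-lit l h = len-disjLit l (isLit⇒isDisjLit l h)

len-∨-≤ : ∀ A B → len (A ∨' B) ≤ 1 + len A + len B
len-∨-≤ A B with isDisjLit A ∧ isDisjLit B
... | true  = s≤s z≤n
... | false = ≤-refl

-- n ≤ 4 (p − 1) without truncated subtraction; a record so that p is inferable.
record _Fits_ (n p : ℕ) : Set where
  constructor fits
  field 4+n≤4*p : 4 + n ≤ 4 * p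

open _Fits_

fits-mono : ∀ {n p q} → p ≤ q → n Fits p → n Fits q
fits-mono p≤q (fits n-fits) = fits (≤-trans n-fits (*-monoʳ-≤ 4 p≤q))

*-suc-+ : ∀ m p q → m * suc (p + q) ≡ m + (m * p + m * q)
*-suc-+ m p q = trans (*-suc m (p + q)) (cong (m +_) (*-distribˡ-+ m p q))

fits-unary : ∀ {c a p} → c ≤ 4 → a Fits p → (c + a) Fits suc p
fits-unary {c} {a} {p} c≤4 (fits a-fits) = fits (begin
  4 + (c + a)  ≤⟨ +-monoʳ-≤ 4 (+-monoˡ-≤ a c≤4) ⟩
  4 + (4 + a)  ≤⟨ +-monoʳ-≤ 4 a-fits ⟩
  4 + 4 * p    ≡⟨ *-suc 4 p ⟨
  4 * suc p    ∎)
  where open ≤-Reasoning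

fits-binary : ∀ {c a b p q} → c ≤ 4 → a Fits p → b Fits q →
              (c + (a + b)) Fits suc (p + q)
fits-binary {c} {a} {b} {p} {q} c≤4 (fits a-fits) (fits b-fits) = fits (begin
  4 + (c + (a + b))        ≤⟨ +-monoʳ-≤ 4 (+-monoˡ-≤ (a + b) c≤4) ⟩
  4 + (4 + (a + b))        ≤⟨ +-monoʳ-≤ 8 (+-monoʳ-≤ a (m≤n+m b 4)) ⟩
  4 + ((4 + a) + (4 + b))  ≤⟨ +-monoʳ-≤ 4 (+-mono-≤ a-fits b-fits) ⟩
  4 + (4 * p + 4 * q)      ≡⟨ *-suc-+ 4 p q ⟨
  4 * suc (p + q)          ∎)
  where open ≤-Reasoning

fits-renameʳ : ∀ {a b p q} → a < 4 * p → b Fits q → suc (a + b) Fits suc (p + q)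
fits-renameʳ {a} {b} {p} {q} a<4p (fits b-fits) = fits (begin
  4 + (suc a + b)      ≤⟨ +-monoʳ-≤ 4 (+-mono-≤ a<4p (≤-trans (m≤n+m b 4) b-fits)) ⟩
  4 + (4 * p + 4 * q)  ≡⟨ *-suc-+ 4 p q ⟨
  4 * suc (p + q)      ∎)
  where open ≤-Reasoning

fits-renameˡ : ∀ {a b p q} → a < 4 * q → b Fits p → suc (a + b) Fits suc (p + q)
fits-renameˡ {a} {b} {p} {q} a<4q b-fits =
  subst (λ n → suc (a + b) Fits suc n) (+-comm q p) (fits-renameʳ a<4q b-fits)

fits-side : ∀ {a b p} → a ≤ 2 → b Fits p → suc (a + b) < 4 * p
fits-side {b = b} a≤2 (fits b-fits) = ≤-trans (+-monoˡ-≤ b (s≤s (s≤s a≤2))) b-fits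

mutual
  fresh-disjLit : ∀ {x D ys} → isDisjLit D ≡ true → τ₁[ x ⇒ D ]↝ ys → length ys ≡ 0
  fresh-disjLit {D = D} {ys} h d = n≤0⇒n≡0 (+-cancelˡ-≤ 4 (length ys) 0 (4+n≤4*p budget))
    where
    budget : length ys Fits 1
    budget = subst (length ys Fits_) (len-disjLit D h) (fresh-bound d)

  fresh-lit𝒰lit : ∀ {x l m ys} → isLit l ≡ true → isLit m ≡ true →
                  τ₁[ x ⇒ l 𝒰 m ]↝ ys → length ys ≡ 1
  fresh-lit𝒰lit hl _ (r-untilL nl _ _) with () ← trans (sym hl) nl
  fresh-lit𝒰lit _ hm (r-untilR nm _ _) with () ← trans (sym hm) nm
  fresh-lit𝒰lit hl hm (r-untilLit {ys = ys} {zs} _ _ d₁ d₂)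
    rewrite length-++ ys {zs}
          | fresh-disjLit (isDisjLit-lit∨lit hl hm) d₁
          | fresh-disjLit (isLit⇒isDisjLit _ hm) d₂ = refl

  fresh-lit𝒲lit : ∀ {x l m ys} → isLit l ≡ true → isLit m ≡ true →
                  τ₁[ x ⇒ l 𝒲 m ]↝ ys → length ys ≡ 1
  fresh-lit𝒲lit hl _ (r-unlessL nl _ _) with () ← trans (sym hl) nl
  fresh-lit𝒲lit _ hm (r-unlessR nm _ _) with () ← trans (sym hm) nm
  fresh-lit𝒲lit hl hm (r-unlessLit {ys = ys} {zs} _ _ d₁ d₂)
    rewrite length-++ ys {zs}
          | fresh-disjLit (isDisjLit-lit∨lit hl hm) d₁
          | fresh-disjLit (isLit⇒isDisjLit _ hm) d₂ = refl

  fresh-var𝒰 : ∀ {x y B ys} → τ₁[ x ⇒ var y 𝒰 B ]↝ ys → length ys < 4 * len B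
  fresh-var𝒰 (r-untilR {ys = ys} {zs} _ d₁ d₂)
    rewrite length-++ ys {zs} | fresh-lit𝒰lit refl refl d₁ =
    fits-side (s≤s z≤n) (fresh-bound d₂)
  fresh-var𝒰 d@(r-untilLit _ hm _ _)
    rewrite fresh-lit𝒰lit refl hm d | len-lit _ hm = s≤s (s≤s z≤n)

  fresh-𝒰var : ∀ {x y A ys} → τ₁[ x ⇒ A 𝒰 var y ]↝ ys → length ys < 4 * len A
  fresh-𝒰var (r-untilL {ys = ys} {zs} _ d₁ d₂)
    rewrite length-++ ys {zs} | fresh-lit𝒰lit refl refl d₁ =
    fits-side (s≤s z≤n) (fresh-bound d₂)
  fresh-𝒰var d@(r-untilLit hl _ _ _)
    rewrite fresh-lit𝒰lit hl refl d | len-lit _ hl = s≤s (s≤s z≤n)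

  fresh-var𝒲 : ∀ {x y B ys} → τ₁[ x ⇒ var y 𝒲 B ]↝ ys → length ys < 4 * len B
  fresh-var𝒲 (r-unlessR {ys = ys} {zs} _ d₁ d₂)
    rewrite length-++ ys {zs} | fresh-lit𝒲lit refl refl d₁ =
    fits-side (s≤s z≤n) (fresh-bound d₂)
  fresh-var𝒲 d@(r-unlessLit _ hm _ _)
    rewrite fresh-lit𝒲lit refl hm d | len-lit _ hm = s≤s (s≤s z≤n)

  fresh-𝒲var : ∀ {x y A ys} → τ₁[ x ⇒ A 𝒲 var y ]↝ ys → length ys < 4 * len A
  fresh-𝒲var (r-unlessL {ys = ys} {zs} _ d₁ d₂)
    rewrite length-++ ys {zs} | fresh-lit𝒲lit refl refl d₁ =
    fits-side (s≤s z≤n) (fresh-bound d₂)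
  fresh-𝒲var d@(r-unlessLit hl _ _ _)
    rewrite fresh-lit𝒲lit hl refl d | len-lit _ hl = s≤s (s≤s z≤n)

  fresh-var∨ : ∀ {x y D ys} → τ₁[ x ⇒ var y ∨' D ]↝ ys → length ys < 4 * len D
  fresh-var∨ {D = D} (r-clause h) rewrite len-disjLit D h = s≤s z≤n
  fresh-var∨ (r-disjR {ys = ys} {zs} _ d₁ d₂)
    rewrite length-++ ys {zs} | fresh-disjLit refl d₁ = fits-side z≤n (fresh-bound d₂)

  fresh-∨var : ∀ {x y D ys} → τ₁[ x ⇒ D ∨' var y ]↝ ys → length ys < 4 * len D
  fresh-∨var {D = D} (r-clause h)
    rewrite len-disjLit D (trans (sym (∧-identityʳ _)) h) = s≤s z≤n
  fresh-∨var (r-disjL {ys = ys} {zs} _ d₁ d₂)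
    rewrite length-++ ys {zs} | fresh-disjLit refl d₁ = fits-side z≤n (fresh-bound d₂)

  fresh-bound : ∀ {x W ys} → τ₁[ x ⇒ W ]↝ ys → length ys Fits len W
  fresh-bound (r-and {ys = ys} {zs} d e)
    rewrite length-++ ys {zs} = fits-binary z≤n (fresh-bound d) (fresh-bound e)
  fresh-bound (r-imp {A = A} {B} d) = fits-mono (len-∨-≤ (¬' A) B) (fresh-bound d)
  fresh-bound (r-nand {A = A} {B} d) = fits-mono (len-∨-≤ (¬' A) (¬' B)) (fresh-bound d)
  fresh-bound (r-nimp {ys = ys} {zs} d e)
    rewrite length-++ ys {zs} = fits-binary z≤n (fresh-bound d) (fresh-bound e)
  fresh-bound (r-nor {ys = ys} {zs} d e)
    rewrite length-++ ys {zs} = fits-binary z≤n (fresh-bound d) (fresh-bound e)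
  fresh-bound (r-next nD d) rewrite nD = fits-unary (s≤s z≤n) (fresh-bound d)
  fresh-bound (r-nnext d) = fits-unary (s≤s z≤n) (fresh-bound d)
  fresh-bound (r-alw _ (r-alwLit _ (r-clause _) (r-clause _)) d) =
    fits-unary (s≤s (s≤s z≤n)) (fresh-bound d)
  fresh-bound (r-nalw d) = fits-unary (s≤s z≤n) (fresh-bound d)
  fresh-bound (r-ev nl d) rewrite nl = fits-unary (s≤s z≤n) (fresh-bound d)
  fresh-bound (r-nev (r-alwLit _ (r-clause _) (r-clause _)) d) =
    fits-unary (s≤s (s≤s z≤n)) (fresh-bound d)
  fresh-bound (r-untilL {ys = ys} {zs} _ d₁ d₂)
    rewrite length-++ ys {zs} = fits-renameˡ (fresh-var𝒰 d₁) (fresh-bound d₂)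
  fresh-bound (r-untilR {ys = ys} {zs} _ d₁ d₂)
    rewrite length-++ ys {zs} = fits-renameʳ (fresh-𝒰var d₁) (fresh-bound d₂)
  fresh-bound (r-unlessL {ys = ys} {zs} _ d₁ d₂)
    rewrite length-++ ys {zs} = fits-renameˡ (fresh-var𝒲 d₁) (fresh-bound d₂)
  fresh-bound (r-unlessR {ys = ys} {zs} _ d₁ d₂)
    rewrite length-++ ys {zs} = fits-renameʳ (fresh-𝒲var d₁) (fresh-bound d₂)
  fresh-bound (r-nuntil {A = A} {B} {as = as} {bs} {ds = ds} d₁ d₂ (r-and (r-clause _) (r-clause _)) d₄)
    rewrite length-++ as {bs ++ ds} | length-++ bs {ds} | fresh-lit𝒲lit refl refl d₁
          | +-comm (lenNeg A) (lenNeg B) = fits-binary ≤-refl (fresh-bound d₂) (fresh-bound d₄)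
  fresh-bound (r-nunless {A = A} {B} {as = as} {bs} {ds = ds} d₁ d₂ (r-and (r-clause _) (r-clause _)) d₄)
    rewrite length-++ as {bs ++ ds} | length-++ bs {ds} | fresh-lit𝒰lit refl refl d₁
          | +-comm (lenNeg A) (lenNeg B) = fits-binary ≤-refl (fresh-bound d₂) (fresh-bound d₄)
  fresh-bound (r-alwLit {ys = ys} _ d (r-clause _))
    rewrite ++-identityʳ ys = fits-unary (s≤s z≤n) (fresh-bound d)
  fresh-bound d@(r-untilLit hl hm _ _)
    rewrite fresh-lit𝒰lit hl hm d | len-lit _ hl | len-lit _ hm = fits (m≤m+n 5 7)
  fresh-bound d@(r-unlessLit hl hm _ _)
    rewrite fresh-lit𝒲lit hl hm d | len-lit _ hl | len-lit _ hm = fits (m≤m+n 5 7)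
  fresh-bound (r-disjR {D = D} {ys = ys} {zs} nA d₁ d₂)
    rewrite length-++ ys {zs} | nA | ∧-zeroʳ (isDisjLit D) =
    fits-renameʳ (fresh-∨var d₁) (fresh-bound d₂)
  fresh-bound (r-disjL {ys = ys} {zs} nA d₁ d₂)
    rewrite length-++ ys {zs} | nA = fits-renameˡ (fresh-var∨ d₁) (fresh-bound d₂)
  fresh-bound (r-clause {D = D} h) rewrite len-disjLit D h = fits ≤-refl
  fresh-bound r-true = fits ≤-refl
  fresh-bound r-false = fits ≤-refl
  fresh-bound (r-evLit h) rewrite h = fits ≤-refl
  fresh-bound (r-nextD h) rewrite h = fits ≤-refl
  fresh-bound (r-ntrue d) = fresh-bound d
  fresh-bound (r-nfalse d) = fresh-bound d
  fresh-bound (r-dneg d) = fresh-bound d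

lemma13 : (x : Sym) (W : Formula) (ys : List Sym) →
          τ₁[ x ⇒ W ]↝ ys → length ys ≤ 4 * len W
lemma13 _ _ ys d = ≤-trans (m≤n+m (length ys) 4) (4+n≤4*p (fresh-bound d))
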